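{- Let $N$ be an odd perfect number with prime factorization $N = p_1^{a_1} p_2^{a_2} \cdots p_k^{a_k}$, where $p_1 < p_2 < \cdots < p_k$ are primes and $a_i \ge 1$, and let $R = p_1 p_2 \cdots p_k$. Then $$\sum_{i=1}^k \left( \frac{1}{p_i^{a_i+1}} + \left(\frac{1}{p_i^{a_i+1}}\right)^2 \right) \ge \frac{1}{R} - \frac{1}{2R^2}.$$
   Context: A positive integer $N$ is perfect if $\sigma(N) = 2N$, where $\sigma(N)$ is the sum of the positive divisors of $N$. -}

module Defs where

open import Data.Nat using (ℕ; zero; suc; _<_)
open import Data.Nat.Divisibility using (_∣?_)
open import Data.List using (List; map; filter; upTo; foldr)
open import Data.Nat.ListAction using (sum)
open import Data.Integer using (+_)
open import Data.Rational using (ℚ; 0ℚ; _/_; _+_)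
open import Relation.Binary.PropositionalEquality using (_≡_)
open import Data.Product using (_×_)

σ : ℕ → ℕ
σ n = sum (filter (_∣? n) (map suc (upTo n)))

IsPerfect : ℕ → Set
IsPerfect N = (0 < N) × (σ N ≡ 2 Data.Nat.* N)

-- reciprocal 1/n as a rational; only ever applied to n ≥ 1
-- (the value at 0 is an irrelevant junk convention)
recip : ℕ → ℚ
recip zero    = 0ℚ
recip (suc n) = (+ 1) / suc n

sumℚ : List ℚ → ℚ
sumℚ = foldr _+_ 0ℚ

-- Write Pᵢ = pᵢ^(aᵢ+1), so that P₁ ⋯ P_k = N·R.  The heart of the proof is the
-- sharper inequality 1/R ≤ Σᵢ 1/Pᵢ, proved in ℕ after clearing denominators.
--  * Multiplicativity of σ on prime powers gives σ(N)·Πᵢ(pᵢ−1) = Πᵢ(Pᵢ−1);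
--    with σ(N) = 2N this reads 2N·T = Q for T = Π(pᵢ−1), Q = Π(Pᵢ−1).
--  * Since Q < ΠPᵢ = N·R we get 2T < R, hence Q + N = N·(2T+1) ≤ N·R.
--  * Expanding Πᵢ Pᵢ = Πᵢ((Pᵢ−1) + 1) gives ΠPᵢ ≤ Q + C with the cofactor sum
--    C = Σᵢ Πⱼ≠ᵢ Pⱼ; therefore N ≤ C, which is N/(N·R) ≤ C/ΠPᵢ = Σ 1/Pᵢ.
-- The theorem follows because 1/R − 1/(2R²) ≤ 1/R and 1/Pᵢ ≤ 1/Pᵢ + 1/Pᵢ².
module Submission where

open import Defs
open import Data.Nat using (ℕ; zero; suc; _+_; _*_; _∸_; _^_; _≤_; _<_; z<s; NonZero; >-nonZero⁻¹)
open import Data.Nat.Properties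
open import Data.Nat.Divisibility
open import Data.Nat.Primality using (Prime; euclidsLemma; prime⇒irreducible; prime⇒nonZero; ¬prime[0]; ¬prime[1])
open import Data.Nat.Coprimality using (Coprime; coprime-divisor; 1-coprimeTo)
open import Data.Nat.ListAction using (sum; product)
open import Data.Nat.ListAction.Properties using (sum-↭; sum-++; product≢0)
open import Data.Fin using (Fin) renaming (_<_ to _<ᶠ_)
open import Data.Fin.Properties using () renaming (<-cmp to <ᶠ-cmp)
open import Data.List using (List; []; _∷_; _++_; map; filter; upTo; allFin)
open import Data.List.Properties using (map-∘)
open import Data.List.Membership.Propositional using (_∈_)
open import Data.List.Membership.Propositional.Properties using (∈-filter⁺; ∈-filter⁻; ∈-map⁺; ∈-map⁻; ∈-upTo⁺; ∈-++⁺ˡ; ∈-++⁺ʳ; ∈-++⁻)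
open import Data.List.Membership.Propositional.Properties.WithK using (unique∧set⇒bag)
open import Data.List.Relation.Binary.BagAndSetEquality using (∼bag⇒↭)
open import Data.List.Relation.Unary.All using (All; []; _∷_; universal)
open import Data.List.Relation.Unary.All.Properties using (map⁺)
open import Data.List.Relation.Unary.AllPairs as AllPairs using (AllPairs; []; _∷_)
open import Data.List.Relation.Unary.Unique.Propositional using (Unique)
import Data.List.Relation.Unary.Unique.Propositional.Properties as Unique
open import Data.Integer as ℤ using () renaming (+_ to ⁺_)
import Data.Integer.Properties as ℤ
open import Data.Rational using (ℚ; 0ℚ; 1ℚ; *≤*; NonNegative; Positive) renaming (_+_ to _+ℚ_; _*_ to _*ℚ_; _-_ to _-ℚ_; _≤_ to _≤ℚ_)
open import Data.Rational.Literals using (fromℤ)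
import Data.Rational.Properties as ℚ
import Data.Rational.Unnormalised as ℚᵘ
import Data.Rational.Unnormalised.Properties as ℚᵘ
open import Algebra.Bundles using (Ring)
open import Algebra.Properties.Semiring.Mult (Ring.semiring ℚ.+-*-ring) using (×-homo-+; ×1-homo-*) renaming (_×_ to _×ℚ_)
open import Data.Product using (_×_; _,_; proj₂)
open import Data.Sum using (inj₁; inj₂)
open import Data.Empty using (⊥-elim)
open import Function.Bundles using (mk⇔)
open import Relation.Nullary using (¬_; yes; no; contradiction)
open import Relation.Binary.Definitions using (tri<; tri≈; tri>)
open import Relation.Binary.PropositionalEquality

divisors : ℕ → List ℕ
divisors n = filter (_∣? n) (map suc (upTo n))

divisors-unique : ∀ n → Unique (divisors n)
divisors-unique n = Unique.filter⁺ (_∣? n) (Unique.map⁺ suc-injective (Unique.upTo⁺ n))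

∈-divisors⁻ : ∀ {n d} → d ∈ divisors n → d ∣ n
∈-divisors⁻ {n} d∈ = proj₂ (∈-filter⁻ (_∣? n) {xs = map suc (upTo n)} d∈)

∈-divisors⁺ : ∀ {n d} .{{_ : NonZero n}} → d ∣ n → d ∈ divisors n
∈-divisors⁺ {suc n} {zero}  0∣n = contradiction (0∣⇒≡0 0∣n) λ ()
∈-divisors⁺ {suc n} {suc d} d∣n = ∈-filter⁺ (_∣? suc n) (∈-map⁺ suc (∈-upTo⁺ (∣⇒≤ d∣n))) d∣n

sum-sameMembers : ∀ {xs ys : List ℕ} → Unique xs → Unique ys →
                  (∀ {z} → z ∈ xs → z ∈ ys) → (∀ {z} → z ∈ ys → z ∈ xs) → sum xs ≡ sum ys
sum-sameMembers xs! ys! ⊆ ⊇ = sum-↭ (∼bag⇒↭ (unique∧set⇒bag xs! ys! (mk⇔ ⊆ ⊇)))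

sum-scale : ∀ c (xs : List ℕ) → sum (map (c *_) xs) ≡ c * sum xs
sum-scale c []       = sym (*-zeroʳ c)
sum-scale c (x ∷ xs) = trans (cong (c * x +_) (sum-scale c xs)) (sym (*-distribˡ-+ c x (sum xs)))

prime∤⇒coprime : ∀ {p d} → Prime p → ¬ p ∣ d → Coprime d p
prime∤⇒coprime pp p∤d (e∣d , e∣p) with prime⇒irreducible pp e∣p
... | inj₁ e≡1 = e≡1
... | inj₂ refl = ⊥-elim (p∤d e∣d)

∣p^a*n⇒∣n : ∀ {p d n} → Prime p → ¬ p ∣ d → ∀ a → d ∣ p ^ a * n → d ∣ n
∣p^a*n⇒∣n {n = n} pp p∤d zero    d∣ = subst (_ ∣_) (+-identityʳ n) d∣
∣p^a*n⇒∣n {p} {d} {n} pp p∤d (suc a) d∣ =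
  ∣p^a*n⇒∣n pp p∤d a (coprime-divisor (prime∤⇒coprime pp p∤d) (subst (d ∣_) (*-assoc p (p ^ a) n) d∣))

-- For p ∤ n, the divisors of p^(a+1)·n are the divisors of n (those prime
-- to p) together with p times the divisors of p^a·n.
σ-prime-power-step : ∀ {p n} → Prime p → ¬ p ∣ n → .{{_ : NonZero n}} → ∀ a →
                     σ (p ^ suc a * n) ≡ σ n + p * σ (p ^ a * n)
σ-prime-power-step {p} {n} pp p∤n a = begin
  σ (p ^ suc a * n)                            ≡⟨ cong σ (*-assoc p (p ^ a) n) ⟩
  sum (divisors (p * m))                       ≡⟨ sum-sameMembers (divisors-unique (p * m)) split! ⊆ ⊇ ⟩
  sum (divisors n ++ map (p *_) (divisors m))  ≡⟨ sum-++ (divisors n) _ ⟩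
  σ n + sum (map (p *_) (divisors m))          ≡⟨ cong (σ n +_) (sum-scale p (divisors m)) ⟩
  σ n + p * σ m                                ∎
  where
  open ≡-Reasoning
  m = p ^ a * n
  instance
    p≢0 : NonZero p
    p≢0 = prime⇒nonZero pp
    m≢0 : NonZero m
    m≢0 = m*n≢0 (p ^ a) n {{m^n≢0 p a}}
    pm≢0 : NonZero (p * m)
    pm≢0 = m*n≢0 p m
  disjoint : ∀ {v} → ¬ (v ∈ divisors n × v ∈ map (p *_) (divisors m))
  disjoint (v∈n , v∈pm) with ∈-map⁻ (p *_) v∈pm
  ... | q , _ , refl = p∤n (∣-trans (m∣m*n q) (∈-divisors⁻ v∈n))
  split! : Unique (divisors n ++ map (p *_) (divisors m))
  split! = Unique.++⁺ (divisors-unique n) (Unique.map⁺ (*-cancelˡ-≡ _ _ p) (divisors-unique m)) disjoint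
  ⊆ : ∀ {d} → d ∈ divisors (p * m) → d ∈ divisors n ++ map (p *_) (divisors m)
  ⊆ {d} d∈ with p ∣? d
  ... | yes (divides q refl) = ∈-++⁺ʳ (divisors n) (subst (_∈ map (p *_) (divisors m)) (*-comm p q)
          (∈-map⁺ (p *_) (∈-divisors⁺ q∣m)))
    where
    q∣m : q ∣ m
    q∣m = *-cancelˡ-∣ p (subst (_∣ p * m) (*-comm q p) (∈-divisors⁻ d∈))
  ... | no p∤d = ∈-++⁺ˡ (∈-divisors⁺ (∣p^a*n⇒∣n pp p∤d (suc a) d∣p^[a+1]n))
    where
    d∣p^[a+1]n : d ∣ p ^ suc a * n
    d∣p^[a+1]n = subst (d ∣_) (sym (*-assoc p (p ^ a) n)) (∈-divisors⁻ d∈)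
  ⊇ : ∀ {d} → d ∈ divisors n ++ map (p *_) (divisors m) → d ∈ divisors (p * m)
  ⊇ d∈ with ∈-++⁻ (divisors n) d∈
  ... | inj₁ d∈n = ∈-divisors⁺ (∣n⇒∣m*n p (∣-trans (∈-divisors⁻ d∈n) (n∣m*n (p ^ a))))
  ... | inj₂ d∈pm with ∈-map⁻ (p *_) d∈pm
  ...   | q , q∈m , refl = ∈-divisors⁺ (*-monoʳ-∣ p (∈-divisors⁻ q∈m))

-- A sequence with S₀ = s and S_{a+1} = s + (q+1)·S_a is the geometric sum
-- s·(1 + (q+1) + ⋯ + (q+1)^a), so S_a·q + s = (q+1)^(a+1)·s.
geometric-recurrence : ∀ (S : ℕ → ℕ) q s → S 0 ≡ s → (∀ a → S (suc a) ≡ s + suc q * S a) →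
                       ∀ a → S a * q + s ≡ suc q ^ suc a * s
geometric-recurrence S q s S₀ S₊ zero = begin
  S 0 * q + s          ≡⟨ cong (λ t → t * q + s) S₀ ⟩
  s * q + s            ≡⟨ +-comm (s * q) s ⟩
  s + s * q            ≡⟨ cong (s +_) (*-comm s q) ⟩
  suc q * s            ≡⟨ cong (_* s) (sym (*-identityʳ (suc q))) ⟩
  suc q ^ 1 * s        ∎
  where open ≡-Reasoning
geometric-recurrence S q s S₀ S₊ (suc a) = begin
  S (suc a) * q + s                ≡⟨ cong (λ t → t * q + s) (S₊ a) ⟩
  (s + suc q * S a) * q + s        ≡⟨ regroup s q (S a) ⟩
  suc q * (S a * q + s)            ≡⟨ cong (suc q *_) (geometric-recurrence S q s S₀ S₊ a) ⟩
  suc q * (suc q ^ suc a * s)      ≡⟨ sym (*-assoc (suc q) (suc q ^ suc a) s) ⟩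
  suc q ^ suc (suc a) * s          ∎
  where
  open ≡-Reasoning
  regroup : ∀ s q t → (s + suc q * t) * q + s ≡ suc q * (t * q + s)
  regroup = solve-∀
    where open import Data.Nat.Tactic.RingSolver using (solve-∀)

σ-prime-power : ∀ {p n} → Prime p → ¬ p ∣ n → .{{_ : NonZero n}} → ∀ a →
                σ (p ^ a * n) * (p ∸ 1) ≡ (p ^ suc a ∸ 1) * σ n
σ-prime-power {zero}  pp = ⊥-elim (¬prime[0] pp)
σ-prime-power {suc q} {n} pp p∤n a = begin
  S a * q                      ≡⟨ sym (m+n∸n≡m (S a * q) (σ n)) ⟩
  S a * q + σ n ∸ σ n          ≡⟨ cong (_∸ σ n) (geometric-recurrence S q (σ n) S₀ S₊ a) ⟩
  suc q ^ suc a * σ n ∸ σ n    ≡⟨ cong (suc q ^ suc a * σ n ∸_) (sym (*-identityˡ (σ n))) ⟩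
  suc q ^ suc a * σ n ∸ 1 * σ n ≡⟨ sym (*-distribʳ-∸ (σ n) (suc q ^ suc a) 1) ⟩
  (suc q ^ suc a ∸ 1) * σ n     ∎
  where
  open ≡-Reasoning
  S : ℕ → ℕ
  S b = σ (suc q ^ b * n)
  S₀ : S 0 ≡ σ n
  S₀ = cong σ (*-identityˡ n)
  S₊ : ∀ b → S (suc b) ≡ σ n + suc q * S b
  S₊ = σ-prime-power-step pp p∤n

-- The cofactor sum Σᵢ Πⱼ≠ᵢ xⱼ of a list of numbers.
cofactorSum : List ℕ → ℕ
cofactorSum []       = 0
cofactorSum (x ∷ xs) = product xs + x * cofactorSum xs

product-pred≤product : ∀ xs → product (map (_∸ 1) xs) ≤ product xs
product-pred≤product []       = ≤-refl
product-pred≤product (x ∷ xs) = *-mono-≤ (m∸n≤m x 1) (product-pred≤product xs)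

product-pred<product : ∀ x xs → All NonZero (x ∷ xs) → product (map (_∸ 1) (x ∷ xs)) < product (x ∷ xs)
product-pred<product x xs (x≢0 ∷ xs≢0) = begin-strict
  (x ∸ 1) * product (map (_∸ 1) xs)  ≤⟨ *-monoʳ-≤ (x ∸ 1) (product-pred≤product xs) ⟩
  (x ∸ 1) * product xs              <⟨ *-monoˡ-< (product xs) {{product≢0 xs≢0}} (∸-monoʳ-< {x} z<s (>-nonZero⁻¹ x {{x≢0}})) ⟩
  x * product xs                    ∎
  where open ≤-Reasoning

-- Expanding Πᵢ((xᵢ−1) + 1) and keeping only the terms with at most one
-- factor 1: Π xᵢ ≤ Π(xᵢ−1) + Σᵢ Πⱼ≠ᵢ xⱼ.
product≤product-pred+cofactorSum : ∀ xs → product xs ≤ product (map (_∸ 1) xs) + cofactorSum xs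
product≤product-pred+cofactorSum []       = ≤-refl
product≤product-pred+cofactorSum (x ∷ xs) = begin
  x * P                      ≤⟨ *-monoʳ-≤ x (product≤product-pred+cofactorSum xs) ⟩
  x * (Q + C)                ≡⟨ *-distribˡ-+ x Q C ⟩
  x * Q + x * C              ≤⟨ +-monoˡ-≤ (x * C) (*-monoˡ-≤ Q (m≤n+m∸n x 1)) ⟩
  (Q + (x ∸ 1) * Q) + x * C  ≤⟨ +-monoˡ-≤ (x * C) (+-monoˡ-≤ ((x ∸ 1) * Q) (product-pred≤product xs)) ⟩
  (P + (x ∸ 1) * Q) + x * C  ≡⟨ cong (_+ x * C) (+-comm P ((x ∸ 1) * Q)) ⟩
  ((x ∸ 1) * Q + P) + x * C  ≡⟨ +-assoc ((x ∸ 1) * Q) P (x * C) ⟩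
  (x ∸ 1) * Q + (P + x * C)  ∎
  where
  open ≤-Reasoning
  P = product xs
  Q = product (map (_∸ 1) xs)
  C = cofactorSum xs

-- The arithmetic core: if 2N·T = Q < N·R ≤ Q + C then N ≤ C.  (Here Q < N·R
-- forces 2T < R, i.e. Q + N = N·(2T+1) ≤ N·R.)
arithmetic-core : ∀ N T R Q C → 2 * N * T ≡ Q → Q < N * R → N * R ≤ Q + C → N ≤ C
arithmetic-core N T R Q C 2NT≡Q Q<NR NR≤Q+C = +-cancelˡ-≤ Q N C (begin
  Q + N            ≡⟨ cong (_+ N) (sym N*2T≡Q) ⟩
  N * (2 * T) + N  ≡⟨ +-comm (N * (2 * T)) N ⟩
  N + N * (2 * T)  ≡⟨ sym (*-suc N (2 * T)) ⟩
  N * suc (2 * T)  ≤⟨ *-monoʳ-≤ N 2T<R ⟩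
  N * R            ≤⟨ NR≤Q+C ⟩
  Q + C            ∎)
  where
  open ≤-Reasoning
  N*2T≡Q : N * (2 * T) ≡ Q
  N*2T≡Q = trans (sym (*-assoc N 2 T)) (trans (cong (_* T) (*-comm N 2)) 2NT≡Q)
  2T<R : 2 * T < R
  2T<R = *-cancelˡ-< N (2 * T) R (subst (_< N * R) (sym N*2T≡Q) Q<NR)

prime∣^⇒∣ : ∀ {p q} → Prime p → ∀ b → p ∣ q ^ b → p ∣ q
prime∣^⇒∣ pp zero    p∣1 = ⊥-elim (¬prime[1] (subst Prime (∣1⇒≡1 p∣1) pp))
prime∣^⇒∣ {q = q} pp (suc b) p∣q^b with euclidsLemma q (q ^ b) pp p∣q^b
... | inj₁ p∣q = p∣q
... | inj₂ p∣q^b′ = prime∣^⇒∣ pp b p∣q^b′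

module PrimePowers {I : Set} (p a : I → ℕ) (prime : ∀ i → Prime (p i)) where

  powerProduct : List I → ℕ
  powerProduct is = product (map (λ i → p i ^ a i) is)

  P : I → ℕ
  P i = p i ^ suc (a i)

  powerProduct≢0 : ∀ is → NonZero (powerProduct is)
  powerProduct≢0 is = product≢0 (map⁺ (universal (λ i → m^n≢0 (p i) (a i) {{prime⇒nonZero (prime i)}}) is))

  P≢0 : ∀ is → All NonZero (map P is)
  P≢0 is = map⁺ (universal (λ i → m^n≢0 (p i) (suc (a i)) {{prime⇒nonZero (prime i)}}) is)

  radical≢0 : ∀ is → NonZero (product (map p is))
  radical≢0 is = product≢0 (map⁺ (universal (λ i → prime⇒nonZero (prime i)) is))

  prime∤powerProduct : ∀ i is → All (λ j → p i ≢ p j) is → ¬ p i ∣ powerProduct is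
  prime∤powerProduct i []       []         p∣1 = ¬prime[1] (subst Prime (∣1⇒≡1 p∣1) (prime i))
  prime∤powerProduct i (j ∷ js) (pᵢ≢pⱼ ∷ ≢s) p∣ with euclidsLemma (p j ^ a j) (powerProduct js) (prime i) p∣
  ... | inj₂ p∣rest = prime∤powerProduct i js ≢s p∣rest
  ... | inj₁ p∣pʲ with prime⇒irreducible (prime j) (prime∣^⇒∣ (prime i) (a j) p∣pʲ)
  ...   | inj₁ pᵢ≡1 = ¬prime[1] (subst Prime pᵢ≡1 (prime i))
  ...   | inj₂ pᵢ≡pⱼ = pᵢ≢pⱼ pᵢ≡pⱼ

  σ-powerProduct : ∀ is → AllPairs (λ i j → p i ≢ p j) is →
                   σ (powerProduct is) * product (map (λ i → p i ∸ 1) is) ≡ product (map (_∸ 1) (map P is))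
  σ-powerProduct []       []         = refl
  σ-powerProduct (i ∷ is) (≢s ∷ ≢ss) = begin
    σ (p i ^ a i * M) * ((p i ∸ 1) * T)  ≡⟨ sym (*-assoc (σ (p i ^ a i * M)) (p i ∸ 1) T) ⟩
    σ (p i ^ a i * M) * (p i ∸ 1) * T    ≡⟨ cong (_* T) (σ-prime-power (prime i) (prime∤powerProduct i is ≢s) {{powerProduct≢0 is}} (a i)) ⟩
    (P i ∸ 1) * σ M * T                  ≡⟨ *-assoc (P i ∸ 1) (σ M) T ⟩
    (P i ∸ 1) * (σ M * T)                ≡⟨ cong ((P i ∸ 1) *_) (σ-powerProduct is ≢ss) ⟩
    (P i ∸ 1) * product (map (_∸ 1) (map P is)) ∎
    where
    open ≡-Reasoning
    M = powerProduct is
    T = product (map (λ j → p j ∸ 1) is)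

  powerProduct-suc : ∀ is → product (map P is) ≡ powerProduct is * product (map p is)
  powerProduct-suc []       = refl
  powerProduct-suc (i ∷ is) = begin
    p i * p i ^ a i * product (map P is)    ≡⟨ cong (p i * p i ^ a i *_) (powerProduct-suc is) ⟩
    p i * p i ^ a i * (M * R)               ≡⟨ cong (_* (M * R)) (*-comm (p i) (p i ^ a i)) ⟩
    p i ^ a i * p i * (M * R)               ≡⟨ [m*n]*[o*p]≡[m*o]*[n*p] (p i ^ a i) (p i) M R ⟩
    p i ^ a i * M * (p i * R)               ∎
    where
    open ≡-Reasoning
    M = powerProduct is
    R = product (map p is)

  -- If N = Πᵢ pᵢ^aᵢ (distinct primes, at least one) is perfect, then N is at
  -- most the cofactor sum Σᵢ Πⱼ≠ᵢ Pⱼ; this is 1/R ≤ Σᵢ 1/Pᵢ with the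
  -- denominators cleared.
  perfect⇒≤cofactorSum : ∀ i is → AllPairs (λ i j → p i ≢ p j) (i ∷ is) →
                         σ (powerProduct (i ∷ is)) ≡ 2 * powerProduct (i ∷ is) →
                         powerProduct (i ∷ is) ≤ cofactorSum (map P (i ∷ is))
  perfect⇒≤cofactorSum i is distinct σN≡2N =
    arithmetic-core N T R Q (cofactorSum Ps)
      (trans (cong (_* T) (sym σN≡2N)) (σ-powerProduct js distinct))
      (subst (Q <_) (powerProduct-suc js) (product-pred<product _ _ (P≢0 js)))
      (subst (_≤ Q + cofactorSum Ps) (powerProduct-suc js) (product≤product-pred+cofactorSum Ps))
    where
    js = i ∷ is
    Ps = map P js
    N = powerProduct js
    R = product (map p js)
    T = product (map (λ j → p j ∸ 1) js)
    Q = product (map (_∸ 1) Ps)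

ι : ℕ → ℚ
ι n = fromℤ (⁺ n)

-- ι n is the n-fold sum 1 + ⋯ + 1, so the library's laws for n-fold sums
-- in a semiring make ι additive and multiplicative.

ι-×1 : ∀ n → n ×ℚ 1ℚ ≡ ι n
ι-×1 zero    = refl
ι-×1 (suc n) = trans (cong (1ℚ +ℚ_) (ι-×1 n)) (ℚ.toℚᵘ-injective (ℚᵘ.≃-trans (ℚ.toℚᵘ-homo-+ 1ℚ (ι n))
  (ℚᵘ.*≡* (cong (λ z → (⁺ 1 ℤ.+ z) ℤ.* ⁺ 1) (ℤ.*-identityʳ (⁺ n))))))

ι-+ : ∀ m n → ι (m + n) ≡ ι m +ℚ ι n
ι-+ m n = trans (sym (ι-×1 (m + n))) (trans (×-homo-+ 1ℚ m n) (cong₂ _+ℚ_ (ι-×1 m) (ι-×1 n)))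

ι-* : ∀ m n → ι (m * n) ≡ ι m *ℚ ι n
ι-* m n = trans (sym (ι-×1 (m * n))) (trans (×1-homo-* m n) (cong₂ _*ℚ_ (ι-×1 m) (ι-×1 n)))

ι-mono : ∀ {m n} → m ≤ n → ι m ≤ℚ ι n
ι-mono m≤n = *≤* (ℤ.*-monoʳ-≤-nonNeg (⁺ 1) (ℤ.+≤+ m≤n))

ι-pos : ∀ n .{{_ : NonZero n}} → Positive (ι n)
ι-pos (suc n) = _

recip*ι : ∀ n .{{_ : NonZero n}} → recip n *ℚ ι n ≡ 1ℚ
recip*ι (suc n) = trans (cong (_*ℚ ι (suc n)) (ℚ.normalize-coprime (1-coprimeTo (suc n)))) (ℚ.*-inverseˡ (ι (suc n)))

recip-nonNeg : ∀ n → NonNegative (recip n)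
recip-nonNeg zero    = _
recip-nonNeg (suc n) = ℚ.normalize-nonNeg 1 (suc n)

sum-recip*product : ∀ xs → All NonZero xs → sumℚ (map recip xs) *ℚ ι (product xs) ≡ ι (cofactorSum xs)
sum-recip*product []       []              = ℚ.*-zeroˡ (ι 1)
sum-recip*product (x ∷ xs) (x≢0 ∷ xs≢0) = begin
  (recip x +ℚ Σ) *ℚ ι (x * P)                         ≡⟨ cong ((recip x +ℚ Σ) *ℚ_) (ι-* x P) ⟩
  (recip x +ℚ Σ) *ℚ (ι x *ℚ ι P)                      ≡⟨ expand (recip x) Σ (ι x) (ι P) ⟩
  recip x *ℚ ι x *ℚ ι P +ℚ ι x *ℚ (Σ *ℚ ι P)          ≡⟨ cong₂ (λ u v → u *ℚ ι P +ℚ ι x *ℚ v) (recip*ι x {{x≢0}}) (sum-recip*product xs xs≢0) ⟩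
  1ℚ *ℚ ι P +ℚ ι x *ℚ ι (cofactorSum xs)              ≡⟨ cong₂ _+ℚ_ (ℚ.*-identityˡ (ι P)) (sym (ι-* x (cofactorSum xs))) ⟩
  ι P +ℚ ι (x * cofactorSum xs)                        ≡⟨ sym (ι-+ P (x * cofactorSum xs)) ⟩
  ι (cofactorSum (x ∷ xs))                             ∎
  where
  open ≡-Reasoning
  P = product xs
  Σ = sumℚ (map recip xs)
  expand : ∀ r s u v → (r +ℚ s) *ℚ (u *ℚ v) ≡ r *ℚ u *ℚ v +ℚ u *ℚ (s *ℚ v)
  expand = solve 4 (λ r s u v → (r :+ s) :* (u :* v) := r :* u :* v :+ u :* (s :* v)) refl
    where open import Data.Rational.Solver using (module +-*-Solver); open +-*-Solver

recip≤sum-recip : ∀ N R xs → All NonZero xs → .{{_ : NonZero R}} →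
                  N * R ≡ product xs → N ≤ cofactorSum xs → recip R ≤ℚ sumℚ (map recip xs)
recip≤sum-recip N R xs xs≢0 NR≡P N≤C =
  ℚ.*-cancelʳ-≤-pos (ι (product xs)) {{ι-pos (product xs) {{product≢0 xs≢0}}}} (begin
    recip R *ℚ ι (product xs)       ≡⟨ cong (λ t → recip R *ℚ ι t) (sym NR≡P) ⟩
    recip R *ℚ ι (N * R)            ≡⟨ cong (recip R *ℚ_) (trans (ι-* N R) (ℚ.*-comm (ι N) (ι R))) ⟩
    recip R *ℚ (ι R *ℚ ι N)         ≡⟨ sym (ℚ.*-assoc (recip R) (ι R) (ι N)) ⟩
    recip R *ℚ ι R *ℚ ι N           ≡⟨ cong (_*ℚ ι N) (recip*ι R) ⟩
    1ℚ *ℚ ι N                       ≡⟨ ℚ.*-identityˡ (ι N) ⟩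
    ι N                             ≤⟨ ι-mono N≤C ⟩
    ι (cofactorSum xs)              ≡⟨ sym (sum-recip*product xs xs≢0) ⟩
    sumℚ (map recip xs) *ℚ ι (product xs) ∎)
  where open ℚ.≤-Reasoning

sum-recip≤sum-recip+square : ∀ xs → sumℚ (map recip xs) ≤ℚ sumℚ (map (λ x → recip x +ℚ recip x *ℚ recip x) xs)
sum-recip≤sum-recip+square []       = ℚ.≤-refl
sum-recip≤sum-recip+square (x ∷ xs) = ℚ.+-mono-≤ (≤+nonNeg (recip x) (recip x *ℚ recip x) square≥0) (sum-recip≤sum-recip+square xs)
  where
  square≥0 : 0ℚ ≤ℚ recip x *ℚ recip x
  square≥0 = ℚ.nonNegative⁻¹ _ {{ℚ.nonNeg*nonNeg⇒nonNeg (recip x) {{recip-nonNeg x}} (recip x) {{recip-nonNeg x}}}}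
  ≤+nonNeg : ∀ r s → 0ℚ ≤ℚ s → r ≤ℚ r +ℚ s
  ≤+nonNeg r s 0≤s = subst (_≤ℚ r +ℚ s) (ℚ.+-identityʳ r) (ℚ.+-monoʳ-≤ r 0≤s)

recip-correction≤recip : ∀ R → recip R -ℚ recip 2 *ℚ (recip R *ℚ recip R) ≤ℚ recip R
recip-correction≤recip R = subst (recip R -ℚ recip 2 *ℚ (recip R *ℚ recip R) ≤ℚ_) (ℚ.+-identityʳ (recip R))
  (ℚ.+-monoʳ-≤ (recip R) (ℚ.neg-antimono-≤ correction≥0))
  where
  instance
    recipR≥0 : NonNegative (recip R)
    recipR≥0 = recip-nonNeg R
  correction≥0 : 0ℚ ≤ℚ recip 2 *ℚ (recip R *ℚ recip R)
  correction≥0 = ℚ.nonNegative⁻¹ _ {{ℚ.nonNeg*nonNeg⇒nonNeg (recip 2) (recip R *ℚ recip R) {{ℚ.nonNeg*nonNeg⇒nonNeg (recip R) (recip R)}}}}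

increasing⇒distinct : ∀ {k} (p : Fin k → ℕ) → (∀ i j → i <ᶠ j → p i < p j) →
                      AllPairs (λ i j → p i ≢ p j) (allFin k)
increasing⇒distinct {k} p increasing = AllPairs.map distinct (Unique.allFin⁺ k)
  where
  distinct : ∀ {i j} → i ≢ j → p i ≢ p j
  distinct {i} {j} i≢j with <ᶠ-cmp i j
  ... | tri< i<j _ _ = <⇒≢ (increasing i j i<j)
  ... | tri≈ _ i≡j _ = λ _ → i≢j i≡j
  ... | tri> _ _ j<i = ≢-sym (<⇒≢ (increasing j i j<i))

-- For k = 0 the number N = 1 is not perfect; otherwise chain the bounds
-- 1/R − 1/(2R²) ≤ 1/R ≤ Σ 1/Pᵢ ≤ Σ (1/Pᵢ + 1/Pᵢ²).
mainTheorem3 : (N : ℕ) → ¬ (2 ∣ N) → IsPerfect N →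
    (k : ℕ) (p a : Fin k → ℕ) →
    (∀ i → Prime (p i)) →
    (∀ i j → i <ᶠ j → p i < p j) →
    (∀ i → 1 ≤ a i) →
    N ≡ product (map (λ i → p i ^ a i) (allFin k)) →
    let R = product (map p (allFin k)) in
    (recip R -ℚ (recip 2 *ℚ (recip R *ℚ recip R)))
      ≤ℚ sumℚ (map (λ i → recip (p i ^ suc (a i)) +ℚ (recip (p i ^ suc (a i)) *ℚ recip (p i ^ suc (a i)))) (allFin k))
mainTheorem3 N _ (_ , σN≡2N) zero    p a prime increasing _ refl with () ← σN≡2N
mainTheorem3 N _ (_ , σN≡2N) (suc k) p a prime increasing _ refl = begin
  recip R -ℚ recip 2 *ℚ (recip R *ℚ recip R)           ≤⟨ recip-correction≤recip R ⟩
  recip R                                              ≤⟨ recip≤sum-recip N R (map P is) (P≢0 is) {{radical≢0 is}}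
                                                            (sym (powerProduct-suc is)) N≤C ⟩
  sumℚ (map recip (map P is))                          ≤⟨ sum-recip≤sum-recip+square (map P is) ⟩
  sumℚ (map (λ x → recip x +ℚ recip x *ℚ recip x) (map P is))
    ≡⟨ cong sumℚ (sym (map-∘ {g = λ x → recip x +ℚ recip x *ℚ recip x} {f = P} is)) ⟩
  sumℚ (map (λ i → recip (P i) +ℚ recip (P i) *ℚ recip (P i)) is) ∎
  where
  open ℚ.≤-Reasoning
  open PrimePowers p a prime
  is = allFin (suc k)
  R = product (map p is)
  N≤C : N ≤ cofactorSum (map P is)
  N≤C = perfect⇒≤cofactorSum _ _ (increasing⇒distinct p increasing) σN≡2N
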